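{- The dynamic $s$-$t$-reachability query is not in unary $\mathrm{DynProp}^*$, not even when restricted to dynamic instances in which the initial graph and all graphs arising from the modifications are 1-layered $s$-$t$-graphs.
   Context: An $s$-$t$-graph is a structure over the schema with one binary relation symbol $E$ and two constants $s,t$; the $s$-$t$-reachability query is true iff there is a directed path from $s$ to $t$. A 1-layered $s$-$t$-graph is one where every edge goes from $s$ to a node of $V\setminus\{s,t\}$ or from such a node to $t$. Dynamic setting: a dynamic schema is a triple $(\tau_{in},\tau_{aux},\tau_{bi})$ of relational schemas (input, auxiliary, built-in). Concrete modifications insert or delete a single tuple of an input relation (constants never modified). An update program has, for every $R\in\tau_{aux}$ and abstract modification $\delta\in\{\mathrm{ins}_S,\mathrm{del}_S\}$ ($S\in\tau_{in}$), a formula $\varphi^R_\delta(\vec x;\vec y)$ over $\tau_{in}\cup\tau_{aux}\cup\tau_{bi}$; after $\delta(\vec a)$ the input is modified, each auxiliary $R$ becomes $\{\vec b:\text{old state}\models\varphi^R_\delta(\vec a;\vec b)\}$, built-in relations never change. A dynamic program $(P,\mathrm{Init},Q)$ has arbitrary initialization maps ($\mathrm{Init}_{aux}$: input database $\mapsto$ auxiliary database; $\mathrm{Init}_{bi}$: domain $\mapsto$ built-in database) and a query symbol $Q\in\tau_{aux}$; it maintains a query if for every input database $\mathcal D$ and every finite modification sequence $\alpha$, $Q$ in the state reached from $(D,\mathcal D,\mathrm{Init}_{aux}(\mathcal D),\mathrm{Init}_{bi}(D))$ by $\alpha$ equals the query answer on $\alpha(\mathcal D)$. $\mathrm{DynProp}^*$: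 update formulas quantifier-free, built-in relations of arbitrary arity allowed. Unary: all auxiliary relation symbols have arity at most $1$ (built-in arities unrestricted). -}

module Defs where

open import Data.Nat using (ℕ; zero; suc; _≤_)
open import Data.Fin using (Fin) renaming (_≟_ to _≟ᶠ_)
open import Data.Vec using (Vec; []; _∷_; map)
open import Data.Bool using (Bool; true; false; not; _∧_; _∨_)
open import Data.List using (List; []; _∷_)
open import Data.Product using (_×_; _,_)
open import Data.Sum using (_⊎_)
open import Data.Unit using (⊤)
open import Relation.Nullary using (¬_)
open import Relation.Nullary.Decidable using (⌊_⌋)
open import Relation.Binary.PropositionalEquality using (_≡_; _≢_; subst; sym)
open import Function.Bundles using (_⇔_)

Graph : ℕ → Set
Graph n = Fin n → Fin n → Bool

data Path {n : ℕ} (E : Graph n) : Fin n → Fin n → Set where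
  here : ∀ {a} → Path E a a
  step : ∀ {a b c} → E a b ≡ true → Path E b c → Path E a c

Reach : ∀ {n} → Graph n → Fin n → Fin n → Set
Reach E s t = Path E s t

OneLayered : ∀ {n} → Graph n → Fin n → Fin n → Set
OneLayered E s t = ∀ a b → E a b ≡ true →
  (a ≡ s × b ≢ s × b ≢ t) ⊎ (a ≢ s × a ≢ t × b ≡ t)

data Kind : Set where
  insK delK : Kind

record Mod (n : ℕ) : Set where
  constructor mod
  field
    kind : Kind
    src  : Fin n
    tgt  : Fin n

applyMod : ∀ {n} → Mod n → Graph n → Graph n
applyMod (mod k a b) E x y with ⌊ x ≟ᶠ a ⌋ ∧ ⌊ y ≟ᶠ b ⌋
... | false = E x y
applyMod (mod insK a b) E x y | true = true
applyMod (mod delK a b) E x y | true = false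

Effective : ∀ {n} → Mod n → Graph n → Set
Effective (mod insK a b) E = E a b ≡ false
Effective (mod delK a b) E = E a b ≡ true

Rel : ℕ → ℕ → Set
Rel n r = Vec (Fin n) r → Bool

record Schema : Set where
  field
    size : ℕ
    ar   : Fin size → ℕ

data Term (v : ℕ) : Set where
  var : Fin v → Term v
  cs  : Term v
  ct  : Term v

data QF (aux bi : Schema) (v : ℕ) : Set where
  eqA  : Term v → Term v → QF aux bi v
  edgeA : Term v → Term v → QF aux bi v
  auxA : (i : Fin (Schema.size aux)) → Vec (Term v) (Schema.ar aux i) → QF aux bi v
  biA  : (j : Fin (Schema.size bi)) → Vec (Term v) (Schema.ar bi j) → QF aux bi v
  negF : QF aux bi v → QF aux bi v
  andF : QF aux bi v → QF aux bi v → QF aux bi v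
  orF  : QF aux bi v → QF aux bi v → QF aux bi v

DB : Schema → ℕ → Set
DB σ n = (i : Fin (Schema.size σ)) → Rel n (Schema.ar σ i)

record State (aux bi : Schema) (n : ℕ) : Set where
  constructor state
  field
    s t  : Fin n
    E    : Graph n
    auxD : DB aux n
    biD  : DB bi n

evalT : ∀ {aux bi n v} → State aux bi n → Vec (Fin n) v → Term v → Fin n
evalT S ρ (var x) = Data.Vec.lookup ρ x
evalT S ρ cs = State.s S
evalT S ρ ct = State.t S

evalQF : ∀ {aux bi n v} → State aux bi n → QF aux bi v → Vec (Fin n) v → Bool
evalQF S (eqA u w) ρ = ⌊ evalT S ρ u ≟ᶠ evalT S ρ w ⌋
evalQF S (edgeA u w) ρ = State.E S (evalT S ρ u) (evalT S ρ w)
evalQF S (auxA i us) ρ = State.auxD S i (map (evalT S ρ) us)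
evalQF S (biA j us) ρ = State.biD S j (map (evalT S ρ) us)
evalQF S (negF φ) ρ = not (evalQF S φ ρ)
evalQF S (andF φ ψ) ρ = evalQF S φ ρ ∧ evalQF S ψ ρ
evalQF S (orF φ ψ) ρ = evalQF S φ ρ ∨ evalQF S ψ ρ

record DynProgram : Set₁ where
  field
    auxS : Schema
    biS  : Schema
    -- update formula φ^R_δ(x₁,x₂ ; ȳ): the first two variables are the
    -- modification parameters, the remaining ar(R) are ȳ
    update : Kind → (i : Fin (Schema.size auxS)) →
             QF auxS biS (suc (suc (Schema.ar auxS i)))
    initAux : (n : ℕ) → (s t : Fin n) → Graph n → DB auxS n
    initBi  : (n : ℕ) → DB biS n
    Q    : Fin (Schema.size auxS)
    Q-ar : Schema.ar auxS Q ≡ 0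

open DynProgram public

Unary : DynProgram → Set
Unary P = ∀ i → Schema.ar (auxS P) i ≤ 1

initState : (P : DynProgram) → ∀ {n} → Fin n → Fin n → Graph n →
            State (auxS P) (biS P) n
initState P {n} s t E = state s t E (initAux P n s t E) (initBi P n)

stepState : (P : DynProgram) → ∀ {n} → Mod n →
            State (auxS P) (biS P) n → State (auxS P) (biS P) n
stepState P m@(mod k a b) S =
  state (State.s S) (State.t S) (applyMod m (State.E S))
        (λ i ys → evalQF S (update P k i) (a ∷ b ∷ ys))
        (State.biD S)

runState : (P : DynProgram) → ∀ {n} → List (Mod n) →
           State (auxS P) (biS P) n → State (auxS P) (biS P) n
runState P [] S = S
runState P (m ∷ α) S = runState P α (stepState P m S)

queryValue : (P : DynProgram) → ∀ {n} → State (auxS P) (biS P) n → Bool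
queryValue P {n} S =
  State.auxD S (Q P) (subst (Vec (Fin n)) (sym (Q-ar P)) [])

applyAll : ∀ {n} → List (Mod n) → Graph n → Graph n
applyAll [] E = E
applyAll (m ∷ α) E = applyAll α (applyMod m E)

Valid1L : ∀ {n} → Fin n → Fin n → Graph n → List (Mod n) → Set
Valid1L s t E [] = ⊤
Valid1L s t E (m ∷ α) =
  Effective m E × OneLayered (applyMod m E) s t × Valid1L s t (applyMod m E) α

Maintains1L : DynProgram → Set
Maintains1L P = ∀ (n : ℕ) (s t : Fin n) (E : Graph n) → OneLayered E s t →
  (α : List (Mod n)) → Valid1L s t E α →
  (queryValue P (runState P α (initState P s t E)) ≡ true
     ⇔ Reach (applyAll α E) s t)

-- Start from the
-- graph with edges s → x → t for x in X = d₁ … d_L e and delete the edges dᵢ → t one by one.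
-- A Ramsey argument on the built-in relations picks X so that, for every i, each later element
-- of X looks exactly like e to the update formulas deleting dᵢ → t. As auxiliary relations are
-- unary, the type of a still connected element (the vector of its auxiliary bits) after i
-- deletions is then Φᵢ(its initial type) for one map Φᵢ on types. With L at least the number
-- of triples (type of s, type of t, Φᵢ), two prefixes i < j agree on this triple. Deleting the
-- remaining edges after either prefix gives the same query bit, but t stays reachable through
-- d_{i+1} in the first run only.

module Submission where

open import Defs
open import Data.Bool using (Bool; true; false; not; _∧_; _∨_; _≟_; if_then_else_)
open import Data.Bool.Properties using (∧-zeroʳ; ∧-identityʳ; ∨-zeroʳ; not-¬; ¬-not)
open import Data.Empty using (⊥-elim)
open import Data.Fin as Fin
  using (Fin; toℕ; zero; suc; combine; funToFin; finToFun) renaming (_≟_ to _≟ᶠ_)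
open import Data.Fin.Properties
  using (suc-injective; pigeonhole; toℕ<n; combine-injective; finToFun-funToFin; 2↔Bool)
open import Data.List as List
  using (List; []; _∷_; _++_; [_]; length; filter; take; drop; foldl; allFin; cartesianProductWith; concatMap)
open import Data.List.Properties using (take++drop≡id; length-map; length-tabulate; ++-assoc; foldl-++)
open import Data.List.Membership.Propositional using (_∈_; _∉_)
open import Data.List.Membership.Propositional.Properties
  using (∈-filter⁻; ∈-++⁺ˡ; ∈-++⁺ʳ; ∈-++⁻; ∈-map⁺; ∈-map⁻; ∈-allFin;
         ∈-cartesianProductWith⁺; ∈-concatMap⁺)
import Data.List.Membership.DecPropositional as DecMembership
open import Data.List.Relation.Binary.Sublist.Propositional
  using (_⊆_; []; _∷_; _∷ʳ_; ⊆-refl; ⊆-trans; minimum)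
open import Data.List.Relation.Binary.Sublist.Propositional.Properties
  using (filter-⊆; Any-resp-⊆; All-resp-⊆; ++⁺; ++⁺ˡ)
open import Data.List.Relation.Unary.All as All using (All; []; _∷_)
open import Data.List.Relation.Unary.Any as Any using (here; there)
open import Data.List.Relation.Unary.Unique.Propositional using (Unique; []; _∷_)
import Data.List.Relation.Unary.Unique.Propositional.Properties as Unique
open import Data.Nat using (ℕ; zero; suc; _+_; _*_; _^_; _≤_; _≤?_; s≤s)
open import Data.Nat.Properties
  using (≤-reflexive; ≤-pred; <⇒≤; ≰⇒>; +-monoˡ-≤; +-cancelˡ-≤; +-suc; +-identityʳ;
         *-assoc; *-identityˡ; m≤n⇒∃[o]m+o≡n; module ≤-Reasoning)
open import Data.Product using (Σ; ∃; ∃₂; _×_; _,_; proj₁; proj₂)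
open import Data.Sum using (_⊎_; inj₁; inj₂; [_,_]′)
open import Data.Unit using (tt)
open import Data.Vec as Vec using (Vec; []; _∷_)
open import Data.Vec.Properties
  using (tabulate-cong; tabulate∘lookup; lookup∘tabulate; lookup-replicate; map-replicate;
         map-cong; map-∘; ≡-dec)
open import Function using (_∘_; id)
open import Function.Bundles using (Inverse; Equivalence; _⇔_; mk⇔)
open import Relation.Nullary using (Dec; yes; no; ¬_; contradiction)
open import Relation.Nullary.Decidable using (⌊_⌋; does-⇔; isYes≗does; dec-true; dec-false)
open import Relation.Binary.PropositionalEquality
  using (_≡_; _≢_; refl; sym; trans; cong; cong₂; subst; module ≡-Reasoning)

-- Homogeneous sublists

module _ {A : Set} where

  length-filter-true+false : (f : A → Bool) (xs : List A) →
    length (filter (λ z → f z ≟ true) xs) + length (filter (λ z → f z ≟ false) xs) ≡ length xs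
  length-filter-true+false f [] = refl
  length-filter-true+false f (x ∷ xs) with f x
  ... | true  = cong suc (length-filter-true+false f xs)
  ... | false = trans (+-suc _ _) (cong suc (length-filter-true+false f xs))

  majority-value : (f : A → Bool) (k : ℕ) (xs : List A) → 2 * k ≤ length xs →
    ∃ λ b → k ≤ length (filter (λ z → f z ≟ b) xs)
  majority-value f k xs 2k≤ with k ≤? length (filter (λ z → f z ≟ true) xs)
  ... | yes k≤ = true , k≤
  ... | no k≰ = false , +-cancelˡ-≤ k _ _ (begin
      k + k                ≡⟨ cong (k +_) (sym (+-identityʳ k)) ⟩
      2 * k                ≤⟨ 2k≤ ⟩
      length xs            ≡⟨ sym (length-filter-true+false f xs) ⟩
      #true + #false       ≤⟨ +-monoˡ-≤ #false (<⇒≤ (≰⇒> k≰)) ⟩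
      k + #false           ∎)
    where
    open ≤-Reasoning
    #true #false : ℕ
    #true  = length (filter (λ z → f z ≟ true) xs)
    #false = length (filter (λ z → f z ≟ false) xs)

endHomogeneousBound : ℕ → ℕ → ℕ
endHomogeneousBound m zero    = 1
endHomogeneousBound m (suc L) = suc (2 ^ m * endHomogeneousBound m L)

module _ {I A : Set} where

  Homogeneous : (I → A → Bool) → List I → List A → Set
  Homogeneous test is ys =
    ∀ {i} → i ∈ is → ∀ {z z′} → z ∈ ys → z′ ∈ ys → test i z ≡ test i z′

  homogeneous-sublist : (test : I → A → Bool) (is : List I) (k : ℕ) (xs : List A) →
    2 ^ length is * k ≤ length xs →
    ∃ λ ys → k ≤ length ys × ys ⊆ xs × Homogeneous test is ys
  homogeneous-sublist test [] k xs k≤ = xs , subst (_≤ length xs) (*-identityˡ k) k≤ , ⊆-refl , λ ()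
  homogeneous-sublist test (i ∷ is) k xs bound
    with b , large ← majority-value (test i) (2 ^ length is * k) xs
                       (subst (_≤ length xs) (*-assoc 2 (2 ^ length is) k) bound)
    with ys , k≤ , ys⊆ , hom ← homogeneous-sublist test is k _ large
    = ys , k≤ , ⊆-trans ys⊆ (filter-⊆ _ xs) , homogeneous
    where
    value : ∀ {z} → z ∈ ys → test i z ≡ b
    value z∈ = proj₂ (∈-filter⁻ (λ z → test i z ≟ b) {xs = xs} (Any-resp-⊆ ys⊆ z∈))
    homogeneous : Homogeneous test (i ∷ is) ys
    homogeneous (here refl) z∈ z′∈ = trans (value z∈) (sym (value z′∈))
    homogeneous (there i∈) = hom i∈

  data EndHomogeneous (test : A → I → A → Bool) (is : List I) (e : A) : List A → Set where
    []  : EndHomogeneous test is e []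
    _∷_ : ∀ {d ds} → (∀ {i} → i ∈ is → ∀ {z} → z ∈ ds → test d i z ≡ test d i e) →
          EndHomogeneous test is e ds → EndHomogeneous test is e (d ∷ ds)

  end-homogeneous-sublist : (test : A → I → A → Bool) (is : List I) (L : ℕ) (xs : List A) →
    endHomogeneousBound (length is) L ≤ length xs →
    ∃₂ λ ds e → length ds ≡ L × ds ++ [ e ] ⊆ xs × EndHomogeneous test is e ds
  end-homogeneous-sublist test is zero (x ∷ xs) _ = [] , x , refl , refl ∷ minimum xs , []
  end-homogeneous-sublist test is (suc L) (x ∷ xs) (s≤s bound)
    with ys , large , ys⊆ , hom ← homogeneous-sublist (test x) is _ xs bound
    with ds , e , refl , ds⊆ , end ← end-homogeneous-sublist test is L ys large
    = x ∷ ds , e , refl , refl ∷ ⊆-trans ds⊆ ys⊆ , x-like-e ∷ end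
    where
    inYs : ∀ {z} → z ∈ ds ++ [ e ] → z ∈ ys
    inYs = Any-resp-⊆ ds⊆
    x-like-e : ∀ {i} → i ∈ is → ∀ {z} → z ∈ ds → test x i z ≡ test x i e
    x-like-e i∈ z∈ = hom i∈ (inYs (∈-++⁺ˡ z∈)) (inYs (∈-++⁺ʳ ds (here refl)))

module _ {A : Set} where

  slice : ∀ i o (as : List A) → i + suc o ≤ length as →
    ∃₂ λ d p₂ → ∃ λ p₃ →
      as ≡ take i as ++ d ∷ p₂ ++ p₃ × take (i + suc o) as ≡ take i as ++ d ∷ p₂
  slice zero o (a ∷ as) _ = a , take o as , drop o as , cong (a ∷_) (sym (take++drop≡id o as)) , refl
  slice (suc i) o (a ∷ as) (s≤s h)
    with d , p₂ , p₃ , split , prefix ← slice i o as h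
    = d , p₂ , p₃ , cong (a ∷_) split , cong (a ∷_) prefix

  repeated-prefix : ∀ {N} (g : List A → Fin N) (as : List A) → N ≤ length as →
    ∃₂ λ p₁ d → ∃₂ λ p₂ p₃ → as ≡ p₁ ++ d ∷ p₂ ++ p₃ × g p₁ ≡ g (p₁ ++ d ∷ p₂)
  repeated-prefix g as N≤
    with i , j , i<j , same ← pigeonhole (s≤s N≤) (λ k → g (take (toℕ k) as))
    with o , i+1+o≡j ← m≤n⇒∃[o]m+o≡n i<j
    with j≡i+1+o ← trans (sym i+1+o≡j) (sym (+-suc (toℕ i) o))
    with d , p₂ , p₃ , split , prefix ←
           slice (toℕ i) o as (subst (_≤ length as) j≡i+1+o (≤-pred (toℕ<n j)))
    = take (toℕ i) as , d , p₂ , p₃ , split ,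
      trans same (trans (cong (λ m → g (take m as)) j≡i+1+o) (cong g prefix))

unique-⊆ : ∀ {A : Set} {xs ys : List A} → xs ⊆ ys → Unique ys → Unique xs
unique-⊆ []        []        = []
unique-⊆ (_ ∷ʳ τ)  (_ ∷ u)   = unique-⊆ τ u
unique-⊆ (refl ∷ τ) (y∉ ∷ u) = All-resp-⊆ τ y∉ ∷ unique-⊆ τ u

unique-middle : ∀ {A : Set} (xs : List A) {y ys} → Unique (xs ++ y ∷ ys) → y ∉ xs ++ ys
unique-middle []       (y∉ys ∷ _) y∈ys        = All.lookup y∉ys y∈ys refl
unique-middle (x ∷ xs) (x∉ ∷ _)   (here refl) = All.lookup x∉ (∈-++⁺ʳ xs (here refl)) refl
unique-middle (x ∷ xs) (_ ∷ u)    (there y∈)  = unique-middle xs u y∈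

-- Coding types and maps of types by numbers

module _ {K : ℕ} where

  bitsToFin : Vec Bool K → Fin (2 ^ K)
  bitsToFin v = funToFin (Inverse.from 2↔Bool ∘ Vec.lookup v)

  finToBits : Fin (2 ^ K) → Vec Bool K
  finToBits c = Vec.tabulate (Inverse.to 2↔Bool ∘ finToFun c)

  finToBits-bitsToFin : ∀ v → finToBits (bitsToFin v) ≡ v
  finToBits-bitsToFin v = trans
    (tabulate-cong λ i → trans (cong (Inverse.to 2↔Bool) (finToFun-funToFin _ i))
                               (Inverse.strictlyInverseˡ 2↔Bool (Vec.lookup v i)))
    (tabulate∘lookup v)

  bitsToFin-injective : ∀ {v w} → bitsToFin v ≡ bitsToFin w → v ≡ w
  bitsToFin-injective {v} {w} eq =
    trans (sym (finToBits-bitsToFin v)) (trans (cong finToBits eq) (finToBits-bitsToFin w))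

  endoToFin : (Vec Bool K → Vec Bool K) → Fin ((2 ^ K) ^ (2 ^ K))
  endoToFin Φ = funToFin (bitsToFin ∘ Φ ∘ finToBits)

  endoToFin-injective : ∀ {Φ Ψ} → endoToFin Φ ≡ endoToFin Ψ → ∀ v → Φ v ≡ Ψ v
  endoToFin-injective {Φ} {Ψ} eq v = begin
    Φ v                        ≡⟨ cong Φ (sym (finToBits-bitsToFin v)) ⟩
    Φ (finToBits (bitsToFin v)) ≡⟨ bitsToFin-injective (pointwise (bitsToFin v)) ⟩
    Ψ (finToBits (bitsToFin v)) ≡⟨ cong Ψ (finToBits-bitsToFin v) ⟩
    Ψ v                        ∎
    where
    open ≡-Reasoning
    pointwise : ∀ c → bitsToFin (Φ (finToBits c)) ≡ bitsToFin (Ψ (finToBits c))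
    pointwise c = trans (sym (finToFun-funToFin _ c))
                        (trans (cong (λ x → finToFun x c) eq) (finToFun-funToFin _ c))

isYes-⇔ : ∀ {P Q : Set} → P ⇔ Q → (p? : Dec P) (q? : Dec Q) → ⌊ p? ⌋ ≡ ⌊ q? ⌋
isYes-⇔ P⇔Q p? q? = trans (isYes≗does p?) (trans (does-⇔ P⇔Q p? q?) (sym (isYes≗does q?)))

module _ {P : Set} where

  isYes-true : (p? : Dec P) → P → ⌊ p? ⌋ ≡ true
  isYes-true p? p = trans (isYes≗does p?) (dec-true p? p)

  isYes-false : (p? : Dec P) → ¬ P → ⌊ p? ⌋ ≡ false
  isYes-false p? ¬p = trans (isYes≗does p?) (dec-false p? ¬p)

  isYes-true⁻¹ : (p? : Dec P) → ⌊ p? ⌋ ≡ true → P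
  isYes-true⁻¹ (yes p) _ = p

module _ {aux bi : Schema} {n v : ℕ} where

  record Indistinguishable (S S′ : State aux bi n) (ρ ρ′ : Vec (Fin n) v) : Set where
    field
      equality  : ∀ u w → (evalT S ρ u ≡ evalT S ρ w) ⇔ (evalT S′ ρ′ u ≡ evalT S′ ρ′ w)
      edge      : ∀ u w → State.E S (evalT S ρ u) (evalT S ρ w)
                        ≡ State.E S′ (evalT S′ ρ′ u) (evalT S′ ρ′ w)
      auxiliary : ∀ i us → State.auxD S i (Vec.map (evalT S ρ) us)
                         ≡ State.auxD S′ i (Vec.map (evalT S′ ρ′) us)
      builtIn   : ∀ j us → State.biD S j (Vec.map (evalT S ρ) us)
                         ≡ State.biD S′ j (Vec.map (evalT S′ ρ′) us)

  evalQF-cong : ∀ {S S′ ρ ρ′} → Indistinguishable S S′ ρ ρ′ →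
    ∀ φ → evalQF S φ ρ ≡ evalQF S′ φ ρ′
  evalQF-cong {S} {S′} {ρ} {ρ′} ind (eqA u w) =
    isYes-⇔ (Indistinguishable.equality ind u w)
            (evalT S ρ u ≟ᶠ evalT S ρ w) (evalT S′ ρ′ u ≟ᶠ evalT S′ ρ′ w)
  evalQF-cong ind (edgeA u w) = Indistinguishable.edge ind u w
  evalQF-cong ind (auxA i us) = Indistinguishable.auxiliary ind i us
  evalQF-cong ind (biA j us)  = Indistinguishable.builtIn ind j us
  evalQF-cong ind (negF φ)    = cong not (evalQF-cong ind φ)
  evalQF-cong ind (andF φ ψ)  = cong₂ _∧_ (evalQF-cong ind φ) (evalQF-cong ind ψ)
  evalQF-cong ind (orF φ ψ)   = cong₂ _∨_ (evalQF-cong ind φ) (evalQF-cong ind ψ)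

module _ {aux : Schema} {n : ℕ} where

  open Schema aux

  auxType : DB aux n → Fin n → Vec Bool size
  auxType A x = Vec.tabulate λ i → A i (Vec.replicate (ar i) x)

  auxType-lookup : ∀ A i x → A i (Vec.replicate (ar i) x) ≡ Vec.lookup (auxType A x) i
  auxType-lookup A i x = sym (lookup∘tabulate _ i)

  constant-tuple : ∀ {B : Set} {r} → r ≤ 1 → B → (us : Vec B r) → ∃ λ u → us ≡ Vec.replicate r u
  constant-tuple _ b []           = b , refl
  constant-tuple _ _ (u ∷ [])     = u , refl
  constant-tuple (s≤s ()) _ (_ ∷ _ ∷ _)

  -- Over a unary schema every auxiliary atom is R(u, …, u) or nullary, so types determine it.
  unary-auxiliary-cong : (∀ i → ar i ≤ 1) → ∀ {B : Set} (A A′ : DB aux n) (f f′ : B → Fin n) → B →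
    (∀ u → auxType A (f u) ≡ auxType A′ (f′ u)) →
    ∀ i us → A i (Vec.map f us) ≡ A′ i (Vec.map f′ us)
  unary-auxiliary-cong unary A A′ f f′ b types i us with u , refl ← constant-tuple (unary i) b us = begin
    A i (Vec.map f (Vec.replicate (ar i) u))   ≡⟨ cong (A i) (map-replicate f u (ar i)) ⟩
    A i (Vec.replicate (ar i) (f u))           ≡⟨ auxType-lookup A i (f u) ⟩
    Vec.lookup (auxType A (f u)) i             ≡⟨ cong (λ τ → Vec.lookup τ i) (types u) ⟩
    Vec.lookup (auxType A′ (f′ u)) i           ≡⟨ sym (auxType-lookup A′ i (f′ u)) ⟩
    A′ i (Vec.replicate (ar i) (f′ u))         ≡⟨ cong (A′ i) (sym (map-replicate f′ u (ar i))) ⟩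
    A′ i (Vec.map f′ (Vec.replicate (ar i) u)) ∎
    where open ≡-Reasoning

allTerms : ∀ v → List (Term v)
allTerms v = cs ∷ ct ∷ List.map var (allFin v)

∈-allTerms : ∀ {v} (u : Term v) → u ∈ allTerms v
∈-allTerms (var x) = there (there (∈-map⁺ var (∈-allFin x)))
∈-allTerms cs      = here refl
∈-allTerms ct      = there (here refl)

allVecs : ∀ {A : Set} → List A → ∀ r → List (Vec A r)
allVecs xs zero    = [ [] ]
allVecs xs (suc r) = cartesianProductWith _∷_ xs (allVecs xs r)

∈-allVecs : ∀ {A : Set} {xs : List A} → (∀ a → a ∈ xs) → ∀ {r} (as : Vec A r) → as ∈ allVecs xs r
∈-allVecs complete []       = here refl
∈-allVecs complete (a ∷ as) = ∈-cartesianProductWith⁺ _∷_ (complete a) (∈-allVecs complete as)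

Atom : Schema → ℕ → Set
Atom σ v = Σ (Fin (Schema.size σ)) λ j → Vec (Term v) (Schema.ar σ j)

atomsWith : ∀ σ v j → List (Atom σ v)
atomsWith σ v j = List.map (j ,_) (allVecs (allTerms v) (Schema.ar σ j))

allAtoms : ∀ σ v → List (Atom σ v)
allAtoms σ v = concatMap (atomsWith σ v) (allFin _)

∈-allAtoms : ∀ σ v (a : Atom σ v) → a ∈ allAtoms σ v
∈-allAtoms σ v (j , us) =
  ∈-concatMap⁺ (atomsWith σ v)
    (Any.map (λ { refl → ∈-map⁺ (j ,_) (∈-allVecs ∈-allTerms us) }) (∈-allFin j))

-- Layered s-t-graphs

∧-true⁻¹ : ∀ {a b} → a ∧ b ≡ true → a ≡ true × b ≡ true
∧-true⁻¹ {true} {true} _ = refl , refl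

∨-true⁻¹ : ∀ {a b} → a ∨ b ≡ true → a ≡ true ⊎ b ≡ true
∨-true⁻¹ {true} _ = inj₁ refl
∨-true⁻¹ {false} b≡true = inj₂ b≡true

_≗₂_ : ∀ {n} → Graph n → Graph n → Set
E ≗₂ F = ∀ x y → E x y ≡ F x y

Path-resp-≗₂ : ∀ {n} {E F : Graph n} → E ≗₂ F → ∀ {a b} → Path E a b → Path F a b
Path-resp-≗₂ E≗F here = here
Path-resp-≗₂ E≗F (step {a} {b} e p) = step (trans (sym (E≗F a b)) e) (Path-resp-≗₂ E≗F p)

applyMod-cong : ∀ {n} (m : Mod n) {E F : Graph n} x y →
  E x y ≡ F x y → applyMod m E x y ≡ applyMod m F x y
applyMod-cong (mod k a b) x y eq with ⌊ x ≟ᶠ a ⌋ ∧ ⌊ y ≟ᶠ b ⌋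
applyMod-cong (mod k a b)    x y eq | false = eq
applyMod-cong (mod insK a b) x y eq | true  = refl
applyMod-cong (mod delK a b) x y eq | true  = refl

applyMod-delete : ∀ {n} (a b : Fin n) (E : Graph n) x y →
  applyMod (mod delK a b) E x y ≡ E x y ∧ not (⌊ x ≟ᶠ a ⌋ ∧ ⌊ y ≟ᶠ b ⌋)
applyMod-delete a b E x y with ⌊ x ≟ᶠ a ⌋ ∧ ⌊ y ≟ᶠ b ⌋
... | true  = sym (∧-zeroʳ (E x y))
... | false = sym (∧-identityʳ (E x y))

delete-core : ∀ a l r i j → (j ≡ true → l ≡ false) →
  ((a ∧ l) ∨ (r ∧ j)) ∧ not (i ∧ j) ≡ (a ∧ l) ∨ ((r ∧ not i) ∧ j)
delete-core a l r i false _
  rewrite ∧-zeroʳ r | ∧-zeroʳ i | ∧-zeroʳ (r ∧ not i) = ∧-identityʳ (a ∧ l ∨ false)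
delete-core a l r i true l≡false
  rewrite l≡false refl | ∧-zeroʳ a | ∧-identityʳ r | ∧-identityʳ i | ∧-identityʳ (r ∧ not i) = refl

module Layered {n : ℕ} (s t : Fin n) where

  layered : (Fin n → Bool) → (Fin n → Bool) → Graph n
  layered L R x y = (⌊ x ≟ᶠ s ⌋ ∧ L y) ∨ (R x ∧ ⌊ y ≟ᶠ t ⌋)

  _─_ : (Fin n → Bool) → Fin n → Fin n → Bool
  (R ─ d) x = R x ∧ not ⌊ x ≟ᶠ d ⌋

  _without_ : (Fin n → Bool) → List (Fin n) → Fin n → Bool
  R without []      = R
  R without (d ∷ D) = (R ─ d) without D

  deletions : List (Fin n) → List (Mod n)
  deletions = List.map λ d → mod delK d t

  Avoids : (Fin n → Bool) → Set
  Avoids R = ∀ x → R x ≡ true → x ≢ s × x ≢ t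

  ─-avoids : ∀ {R d} → Avoids R → Avoids (R ─ d)
  ─-avoids R-avoids x eq = R-avoids x (proj₁ (∧-true⁻¹ eq))

  without-true : ∀ D R {x} → (R without D) x ≡ true → R x ≡ true
  without-true []      R eq = eq
  without-true (d ∷ D) R eq = proj₁ (∧-true⁻¹ (without-true D (R ─ d) eq))

  without-∉ : ∀ D R {x} → x ∉ D → (R without D) x ≡ R x
  without-∉ []      R _ = refl
  without-∉ (d ∷ D) R {x} x∉ = trans (without-∉ D (R ─ d) (x∉ ∘ there))
    (trans (cong (λ b → R x ∧ not b) (isYes-false (x ≟ᶠ d) (x∉ ∘ here))) (∧-identityʳ (R x)))

  without-∈ : ∀ D R {x} → x ∈ D → (R without D) x ≡ false
  without-∈ (d ∷ D) R (there x∈) = without-∈ D (R ─ d) x∈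
  without-∈ (x ∷ D) R {x} (here refl) = ¬-not λ eq →
    not-¬ (cong not (isYes-true (x ≟ᶠ x) refl)) (proj₂ (∧-true⁻¹ (without-true D (R ─ x) eq)))

  without-covered : ∀ D R → (∀ x → R x ≡ true → x ∈ D) → ∀ x → (R without D) x ≡ false
  without-covered D R covered x = ¬-not λ eq →
    not-¬ (without-∈ D R (covered x (without-true D R eq))) eq

  layered-twins : ∀ L R {y e} → y ≢ s → e ≢ s → y ≢ t → e ≢ t → L y ≡ L e → R y ≡ R e →
    (∀ z → layered L R y z ≡ layered L R e z) × (∀ z → layered L R z y ≡ layered L R z e)
  layered-twins L R {y} {e} y≢s e≢s y≢t e≢t Ly≡Le Ry≡Re =
    (λ z → cong₂ (λ a b → (a ∧ L z) ∨ (b ∧ ⌊ z ≟ᶠ t ⌋))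
                 (same (y ≟ᶠ s) (e ≟ᶠ s) y≢s e≢s) Ry≡Re) ,
    (λ z → cong₂ (λ a b → (⌊ z ≟ᶠ s ⌋ ∧ a) ∨ (R z ∧ b))
                 Ly≡Le (same (y ≟ᶠ t) (e ≟ᶠ t) y≢t e≢t))
    where
    same : ∀ {A B : Set} (a? : Dec A) (b? : Dec B) → ¬ A → ¬ B → ⌊ a? ⌋ ≡ ⌊ b? ⌋
    same a? b? ¬a ¬b = trans (isYes-false a? ¬a) (sym (isYes-false b? ¬b))

  module _ {L : Fin n → Bool} (L-avoids : Avoids L) where

    Lt≡false : L t ≡ false
    Lt≡false with L t in Lt
    ... | true  = contradiction refl (proj₂ (L-avoids t Lt))
    ... | false = refl

    delete-edge-to-t : ∀ {E} R d → E ≗₂ layered L R →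
      applyMod (mod delK d t) E ≗₂ layered L (R ─ d)
    delete-edge-to-t R d E≗ x y =
      trans (applyMod-cong (mod delK d t) x y (E≗ x y))
      (trans (applyMod-delete d t (layered L R) x y)
             (delete-core ⌊ x ≟ᶠ s ⌋ (L y) (R x) ⌊ x ≟ᶠ d ⌋ ⌊ y ≟ᶠ t ⌋
               λ y≟t → subst (λ z → L z ≡ false) (sym (isYes-true⁻¹ (y ≟ᶠ t) y≟t)) Lt≡false))

    deletions-shape : ∀ D {E} R → E ≗₂ layered L R →
      applyAll (deletions D) E ≗₂ layered L (R without D)
    deletions-shape []      R E≗ = E≗
    deletions-shape (d ∷ D) R E≗ = deletions-shape D (R ─ d) (delete-edge-to-t R d E≗)

    layered-oneLayered : ∀ {R} → Avoids R → ∀ {E} → E ≗₂ layered L R → OneLayered E s t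
    layered-oneLayered {R} R-avoids E≗ a b edge with ∨-true⁻¹ (trans (sym (E≗ a b)) edge)
    ... | inj₁ from-s with a≟s , Lb ← ∧-true⁻¹ from-s =
      inj₁ (isYes-true⁻¹ (a ≟ᶠ s) a≟s , L-avoids b Lb)
    ... | inj₂ to-t with Ra , b≟t ← ∧-true⁻¹ to-t =
      inj₂ (proj₁ (R-avoids a Ra) , proj₂ (R-avoids a Ra) , isYes-true⁻¹ (b ≟ᶠ t) b≟t)

    deletions-valid : ∀ D {E} R → Avoids R → E ≗₂ layered L R → Unique D →
      (∀ {d} → d ∈ D → R d ≡ true) → Valid1L s t E (deletions D)
    deletions-valid []      R _ _ _ _ = tt
    deletions-valid (d ∷ D) {E} R R-avoids E≗ (d∉D ∷ unique) R-on-D =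
      edge-present , layered-oneLayered (─-avoids R-avoids) E≗′ ,
      deletions-valid D (R ─ d) (─-avoids R-avoids) E≗′ unique R-on-D′
      where
      E≗′ : applyMod (mod delK d t) E ≗₂ layered L (R ─ d)
      E≗′ = delete-edge-to-t R d E≗
      edge-present : E d t ≡ true
      edge-present = trans (E≗ d t)
        (trans (cong (_ ∨_) (cong₂ _∧_ (R-on-D (here refl)) (isYes-true (t ≟ᶠ t) refl))) (∨-zeroʳ _))
      R-on-D′ : ∀ {d′} → d′ ∈ D → (R ─ d) d′ ≡ true
      R-on-D′ {d′} d′∈D = cong₂ _∧_ (R-on-D (there d′∈D))
        (cong not (isYes-false (d′ ≟ᶠ d) λ d′≡d → All.lookup d∉D d′∈D (sym d′≡d)))

    layered-reach : ∀ R {d} → L d ≡ true → R d ≡ true → Path (layered L R) s t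
    layered-reach R {d} Ld Rd = step s→d (step d→t here)
      where
      s→d : layered L R s d ≡ true
      s→d = cong (_∨ _) (cong₂ _∧_ (isYes-true (s ≟ᶠ s) refl) Ld)
      d→t : layered L R d t ≡ true
      d→t = trans (cong (_ ∨_) (cong₂ _∧_ Rd (isYes-true (t ≟ᶠ t) refl))) (∨-zeroʳ _)

    -- With an empty right layer, no edge leaves a node other than s.
    layered-unreachable : s ≢ t → ∀ {R} → (∀ x → R x ≡ false) → ¬ Path (layered L R) s t
    layered-unreachable s≢t R≡false here = s≢t refl
    layered-unreachable s≢t {R} R≡false (step {b = b} s→b b⇝t) with ∨-true⁻¹ s→b
    ... | inj₂ s-to-t = not-¬ (R≡false s) (proj₁ (∧-true⁻¹ s-to-t))
    ... | inj₁ s-to-L with b≢s , b≢t ← L-avoids b (proj₂ (∧-true⁻¹ s-to-L)) with b⇝t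
    ...   | here = b≢t refl
    ...   | step b→c _ with ∨-true⁻¹ b→c
    ...     | inj₁ from-s = b≢s (isYes-true⁻¹ (b ≟ᶠ s) (proj₁ (∧-true⁻¹ from-s)))
    ...     | inj₂ to-t   = not-¬ (R≡false b) (proj₁ (∧-true⁻¹ to-t))

-- Deleting edges into t with a unary program

module _ {n : ℕ} where

  -- How two valuations place the twins y and e: swapped, or at a common element distinct from both.
  data Twinned (y e : Fin n) : Fin n → Fin n → Set where
    fixed   : ∀ {x} → x ≢ y → x ≢ e → Twinned y e x x
    swapped : Twinned y e y e

  twinned-≡ : ∀ {y e a a′ b b′} → Twinned y e a a′ → Twinned y e b b′ → (a ≡ b) ⇔ (a′ ≡ b′)
  twinned-≡ (fixed _ _)     (fixed _ _)     = mk⇔ id id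
  twinned-≡ (fixed a≢y a≢e) swapped         = mk⇔ (⊥-elim ∘ a≢y) (⊥-elim ∘ a≢e)
  twinned-≡ swapped         (fixed b≢y b≢e) = mk⇔ (⊥-elim ∘ b≢y ∘ sym) (⊥-elim ∘ b≢e ∘ sym)
  twinned-≡ swapped         swapped         = mk⇔ (λ _ → refl) (λ _ → refl)

  twinned-edge : ∀ {E : Graph n} {y e} → (∀ z → E y z ≡ E e z) → (∀ z → E z y ≡ E z e) →
    ∀ {a a′ b b′} → Twinned y e a a′ → Twinned y e b b′ → E a b ≡ E a′ b′
  twinned-edge out in′ (fixed _ _) (fixed _ _) = refl
  twinned-edge out in′ {a = a} (fixed _ _) swapped = in′ a
  twinned-edge out in′ {b = b} swapped (fixed _ _) = out b
  twinned-edge {y = y} {e} out in′ swapped swapped = trans (out y) (in′ e)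

replicate-≡ : ∀ {A : Set} r {x e : A} (y : A) → Vec.replicate r x ≡ Vec.replicate r e → x ≢ e →
  Vec.replicate r y ≡ Vec.replicate r x
replicate-≡ zero    y _  _   = refl
replicate-≡ (suc r) y eq x≢e = ⊥-elim (x≢e (cong Vec.head eq))

Vec₀-irrelevant : ∀ {A : Set} {m} → m ≡ 0 → (u v : Vec A m) → u ≡ v
Vec₀-irrelevant refl [] [] = refl

module Run (P : DynProgram) (unary : Unary P) (n : ℕ) (s t : Fin n) where

  open Layered s t using (deletions)
  open Schema (auxS P) using (ar) renaming (size to K)

  Type : Set
  Type = Vec Bool K

  Config : Set
  Config = Graph n × DB (auxS P) n

  toState : Config → State (auxS P) (biS P) n
  toState c = state s t (proj₁ c) (proj₂ c) (initBi P n)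

  deleteStep : Config → Fin n → Config
  deleteStep c d = applyMod (mod delK d t) (proj₁ c) ,
                   λ i ys → evalQF (toState c) (update P delK i) (d ∷ t ∷ ys)

  runState-deletions : ∀ D c → runState P (deletions D) (toState c) ≡ toState (foldl deleteStep c D)
  runState-deletions []      c = refl
  runState-deletions (d ∷ D) c = runState-deletions D (deleteStep c d)

  queryValue-toState : ∀ c → queryValue P (toState c) ≡ Vec.lookup (auxType (proj₂ c) s) (Q P)
  queryValue-toState c =
    trans (cong (proj₂ c (Q P)) (Vec₀-irrelevant (Q-ar P) _ _)) (auxType-lookup (proj₂ c) (Q P) s)

  overwrite : DB (auxS P) n → Fin n → Type → DB (auxS P) n
  overwrite A e τ i xs = if ⌊ ≡-dec _≟ᶠ_ xs (Vec.replicate (ar i) e) ⌋ then Vec.lookup τ i else A i xs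

  overwrite-self : ∀ A e τ → auxType (overwrite A e τ) e ≡ τ
  overwrite-self A e τ = trans
    (tabulate-cong λ i → cong (if_then Vec.lookup τ i else A i (Vec.replicate (ar i) e))
                               (isYes-true (≡-dec _≟ᶠ_ (Vec.replicate (ar i) e) _) refl))
    (tabulate∘lookup τ)

  -- Nullary relations are shared by all elements; that is why the new type is taken from A.
  overwrite-elsewhere : ∀ A e y {x} → x ≢ e → auxType (overwrite A e (auxType A y)) x ≡ auxType A x
  overwrite-elsewhere A e y {x} x≢e = tabulate-cong unchanged
    where
    unchanged : ∀ i → overwrite A e (auxType A y) i (Vec.replicate (ar i) x) ≡ A i (Vec.replicate (ar i) x)
    unchanged i with ≡-dec _≟ᶠ_ (Vec.replicate (ar i) x) (Vec.replicate (ar i) e)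
    ... | yes x̄≡ē = trans (sym (auxType-lookup A i y)) (cong (A i) (replicate-≡ (ar i) y x̄≡ē x≢e))
    ... | no _ = refl

  termValue : ∀ {v} → Vec (Fin n) v → Term v → Fin n
  termValue ρ (var x) = Vec.lookup ρ x
  termValue ρ cs      = s
  termValue ρ ct      = t

  evalT-toState : ∀ c {v} (ρ : Vec (Fin n) v) u → evalT (toState c) ρ u ≡ termValue ρ u
  evalT-toState c ρ (var x) = refl
  evalT-toState c ρ cs      = refl
  evalT-toState c ρ ct      = refl

  -- the type e gets when the edge (d, t) is deleted in c, provided e had type τ before
  updatedType : Config → Fin n → Fin n → Type → Type
  updatedType c d e τ = Vec.tabulate λ i →
    evalQF (toState (proj₁ c , overwrite (proj₂ c) e τ)) (update P delK i) (d ∷ t ∷ Vec.replicate (ar i) e)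

  record Twins (E : Graph n) (d y e : Fin n) : Set where
    field
      d-apart : d ≢ y × d ≢ e
      t-apart : t ≢ y × t ≢ e
      s-apart : s ≢ y × s ≢ e
      same-out : ∀ z → E y z ≡ E e z
      same-in  : ∀ z → E z y ≡ E z e
      same-builtIn : ∀ j us → initBi P n j (Vec.map (termValue (d ∷ t ∷ y ∷ [])) us)
                            ≡ initBi P n j (Vec.map (termValue (d ∷ t ∷ e ∷ [])) us)

  -- Under a valuation d ∷ t ∷ replicate r y every variable after the first two denotes y.
  collapse : ∀ {r} → Term (suc (suc r)) → Term 3
  collapse (var zero)          = var zero
  collapse (var (suc zero))    = var (suc zero)
  collapse (var (suc (suc _))) = var (suc (suc zero))
  collapse cs = cs
  collapse ct = ct

  collapse-value : ∀ c r d y u →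
    evalT (toState c) (d ∷ t ∷ Vec.replicate r y) u ≡ termValue (d ∷ t ∷ y ∷ []) (collapse u)
  collapse-value c r d y (var zero)          = refl
  collapse-value c r d y (var (suc zero))    = refl
  collapse-value c r d y (var (suc (suc k))) = lookup-replicate k y
  collapse-value c r d y cs = refl
  collapse-value c r d y ct = refl

  deleteStep-twin : ∀ c d {y e} → Twins (proj₁ c) d y e →
    auxType (proj₂ (deleteStep c d)) y ≡ updatedType c d e (auxType (proj₂ c) y)
  deleteStep-twin c d {y} {e} twins =
    tabulate-cong λ i → evalQF-cong (indistinguishable (ar i)) (update P delK i)
    where
    open Twins twins
    c′ : Config
    c′ = proj₁ c , overwrite (proj₂ c) e (auxType (proj₂ c) y)
    module _ (r : ℕ) where
      ρ ρ′ : Vec (Fin n) (suc (suc r))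
      ρ  = d ∷ t ∷ Vec.replicate r y
      ρ′ = d ∷ t ∷ Vec.replicate r e

      twinned : ∀ u → Twinned y e (evalT (toState c) ρ u) (evalT (toState c′) ρ′ u)
      twinned (var zero)          = fixed (proj₁ d-apart) (proj₂ d-apart)
      twinned (var (suc zero))    = fixed (proj₁ t-apart) (proj₂ t-apart)
      twinned (var (suc (suc k))) rewrite lookup-replicate k y | lookup-replicate k e = swapped
      twinned cs = fixed (proj₁ s-apart) (proj₂ s-apart)
      twinned ct = fixed (proj₁ t-apart) (proj₂ t-apart)

      same-type : ∀ {a a′} → Twinned y e a a′ → auxType (proj₂ c) a ≡ auxType (proj₂ c′) a′
      same-type (fixed _ a≢e) = sym (overwrite-elsewhere (proj₂ c) e y a≢e)
      same-type swapped       = sym (overwrite-self (proj₂ c) e _)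

      indistinguishable : Indistinguishable (toState c) (toState c′) ρ ρ′
      indistinguishable = record
        { equality  = λ u w → twinned-≡ (twinned u) (twinned w)
        ; edge      = λ u w → twinned-edge same-out same-in (twinned u) (twinned w)
        ; auxiliary = unary-auxiliary-cong unary (proj₂ c) (proj₂ c′)
                        (evalT (toState c) ρ) (evalT (toState c′) ρ′) cs
                        (same-type ∘ twinned)
        ; builtIn   = λ j us → begin
            initBi P n j (Vec.map (evalT (toState c) ρ) us)
              ≡⟨ cong (initBi P n j) (trans (map-cong (collapse-value c r d y) us) (map-∘ _ collapse us)) ⟩
            initBi P n j (Vec.map (termValue (d ∷ t ∷ y ∷ [])) (Vec.map collapse us))
              ≡⟨ same-builtIn j (Vec.map collapse us) ⟩
            initBi P n j (Vec.map (termValue (d ∷ t ∷ e ∷ [])) (Vec.map collapse us))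
              ≡⟨ cong (initBi P n j)
                      (sym (trans (map-cong (collapse-value c′ r d e) us) (map-∘ _ collapse us))) ⟩
            initBi P n j (Vec.map (evalT (toState c′) ρ′) us) ∎
        }
        where open ≡-Reasoning

  Agree : (Fin n → Set) → Config → Config → Set
  Agree Z c c′ = (∀ {x} → Z x → ∀ y → proj₁ c x y ≡ proj₁ c′ x y)
               × (∀ {x} → Z x → auxType (proj₂ c) x ≡ auxType (proj₂ c′) x)

  deleteStep-agree : ∀ {Z} → Z s → Z t → ∀ {d} → Z d → ∀ {c c′} → Agree Z c c′ →
    Agree Z (deleteStep c d) (deleteStep c′ d)
  deleteStep-agree {Z} Zs Zt {d} Zd {c} {c′} (rows , types) =
    (λ {x} Zx y → applyMod-cong (mod delK d t) {proj₁ c} {proj₁ c′} x y (rows Zx y)) ,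
    (λ {x} Zx → tabulate-cong λ i → evalQF-cong (indistinguishable Zx (ar i)) (update P delK i))
    where
    module _ {x} (Zx : Z x) (r : ℕ) where
      ρ : Vec (Fin n) (suc (suc r))
      ρ = d ∷ t ∷ Vec.replicate r x

      inZ : ∀ u → Z (evalT (toState c) ρ u)
      inZ (var zero)          = Zd
      inZ (var (suc zero))    = Zt
      inZ (var (suc (suc k))) = subst Z (sym (lookup-replicate k x)) Zx
      inZ cs = Zs
      inZ ct = Zt

      same : ∀ u → evalT (toState c) ρ u ≡ evalT (toState c′) ρ u
      same u = trans (evalT-toState c ρ u) (sym (evalT-toState c′ ρ u))

      indistinguishable : Indistinguishable (toState c) (toState c′) ρ ρ
      indistinguishable = record
        { equality  = λ u w → mk⇔ (λ eq → trans (sym (same u)) (trans eq (same w)))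
                                  (λ eq → trans (same u) (trans eq (sym (same w))))
        ; edge      = λ u w → trans (rows (inZ u) _) (cong₂ (proj₁ c′) (same u) (same w))
        ; auxiliary = unary-auxiliary-cong unary (proj₂ c) (proj₂ c′)
                        (evalT (toState c) ρ) (evalT (toState c′) ρ) cs
                        λ u →
                        trans (types (inZ u)) (cong (auxType (proj₂ c′)) (same u))
        ; builtIn   = λ j us → cong (initBi P n j) (map-cong same us)
        }

  deletions-agree : ∀ {Z} → Z s → Z t → ∀ {D} → All Z D → ∀ {c c′} → Agree Z c c′ →
    Agree Z (foldl deleteStep c D) (foldl deleteStep c′ D)
  deletions-agree Zs Zt []         agree = agree
  deletions-agree Zs Zt (Zd ∷ ZD) agree = deletions-agree Zs Zt ZD (deleteStep-agree Zs Zt Zd agree)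

module LowerBound (P : DynProgram) (unary : Unary P) where

  K : ℕ
  K = Schema.size (auxS P)

  codes : ℕ
  codes = 2 ^ K * (2 ^ K * (2 ^ K) ^ (2 ^ K))

  atoms : List (Atom (biS P) 3)
  atoms = allAtoms (biS P) 3

  k : ℕ
  k = endHomogeneousBound (length atoms) codes

  n : ℕ
  n = suc (suc k)

  s t : Fin n
  s = zero
  t = suc zero

  open Layered s t
  open Run P unary n s t

  pool : List (Fin n)
  pool = List.map (Fin.suc ∘ Fin.suc) (allFin k)

  pool-length : length pool ≡ k
  pool-length = trans (length-map _ (allFin k)) (length-tabulate id)

  pool-unique : Unique pool
  pool-unique = Unique.map⁺ (suc-injective ∘ suc-injective) (Unique.allFin⁺ k)

  pool-avoids : ∀ {z} → z ∈ pool → z ≢ s × z ≢ t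
  pool-avoids z∈ with _ , _ , refl ← ∈-map⁻ (Fin.suc ∘ Fin.suc) z∈ = (λ ()) , (λ ())

  twinTest : Fin n → Atom (biS P) 3 → Fin n → Bool
  twinTest d (j , us) z = initBi P n j (Vec.map (termValue (d ∷ t ∷ z ∷ [])) us)

  module Chosen (ds : List (Fin n)) (e : Fin n) (X⊆pool : ds ++ [ e ] ⊆ pool)
                (end : EndHomogeneous twinTest atoms e ds) where

    open DecMembership (_≟ᶠ_ {n}) using (_∈?_)

    X : List (Fin n)
    X = ds ++ [ e ]

    X-unique : Unique X
    X-unique = unique-⊆ X⊆pool pool-unique

    X-avoids : ∀ {z} → z ∈ X → z ≢ s × z ≢ t
    X-avoids = pool-avoids ∘ Any-resp-⊆ X⊆pool

    inX : Fin n → Bool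
    inX z = ⌊ z ∈? X ⌋

    inX-avoids : Avoids inX
    inX-avoids z z∈ = X-avoids (isYes-true⁻¹ (z ∈? X) z∈)

    E₀ : Graph n
    E₀ = layered inX inX

    E₀-oneLayered : OneLayered E₀ s t
    E₀-oneLayered = layered-oneLayered inX-avoids inX-avoids λ _ _ → refl

    c₀ : Config
    c₀ = E₀ , initAux P n s t E₀

    -- a configuration together with the map from initial to current types of connected nodes
    Tracker : Set
    Tracker = Config × (Type → Type)

    start : Tracker
    start = c₀ , id

    next : Tracker → Fin n → Tracker
    next y d = deleteStep (proj₁ y) d , updatedType (proj₁ y) d e ∘ proj₂ y

    code : Tracker → Fin codes
    code y = combine (bitsToFin (auxType (proj₂ (proj₁ y)) s))
                     (combine (bitsToFin (auxType (proj₂ (proj₁ y)) t)) (endoToFin (proj₂ y)))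

    code-injective : ∀ {y y′} → code y ≡ code y′ →
      auxType (proj₂ (proj₁ y)) s ≡ auxType (proj₂ (proj₁ y′)) s ×
      auxType (proj₂ (proj₁ y)) t ≡ auxType (proj₂ (proj₁ y′)) t ×
      (∀ τ → proj₂ y τ ≡ proj₂ y′ τ)
    code-injective same
      with s-code , rest   ← combine-injective _ _ _ _ same
      with t-code , Φ-code ← combine-injective _ _ _ _ rest
      = bitsToFin-injective s-code , bitsToFin-injective t-code , endoToFin-injective Φ-code

    foldl-next : ∀ D y → proj₁ (foldl next y D) ≡ foldl deleteStep (proj₁ y) D
    foldl-next []      y = refl
    foldl-next (d ∷ D) y = foldl-next D (next y d)

    record Tracks (y : Tracker) (R : List (Fin n)) : Set where
      field
        right        : Fin n → Bool
        shape        : proj₁ (proj₁ y) ≗₂ layered inX right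
        right-⊆-X    : ∀ z → right z ≡ true → z ∈ X
        right-on-R   : ∀ {z} → z ∈ R → right z ≡ true
        tracked-type : ∀ {z} → z ∈ R →
                       auxType (proj₂ (proj₁ y)) z ≡ proj₂ y (auxType (proj₂ c₀) z)

      right-outside : ∀ {z} → z ∉ X → right z ≡ false
      right-outside z∉ = ¬-not (z∉ ∘ right-⊆-X _)

    tracks-start : Tracks start X
    tracks-start = record
      { right = inX ; shape = λ _ _ → refl ; right-⊆-X = λ z → isYes-true⁻¹ (z ∈? X)
      ; right-on-R = λ {z} → isYes-true (z ∈? X) ; tracked-type = λ _ → refl }

    tracks-next : ∀ {y d R} → Tracks y (d ∷ R) → d ∉ R → e ∈ R → (∀ {z} → z ∈ R → z ∈ X) →
      (∀ {z} → z ∈ R → ∀ {a} → a ∈ atoms → twinTest d a z ≡ twinTest d a e) → Tracks (next y d) R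
    tracks-next {y} {d} {R} tracks d∉R e∈R R⊆X twin = record
      { right        = right ─ d
      ; shape        = delete-edge-to-t inX-avoids right d shape
      ; right-⊆-X    = λ z eq → right-⊆-X z (proj₁ (∧-true⁻¹ eq))
      ; right-on-R   = λ z∈ → cong₂ _∧_ (right-on-R (there z∈))
                                         (cong not (isYes-false (_ ≟ᶠ d) (d∉R ∘ apart z∈)))
      ; tracked-type = λ z∈ → trans (deleteStep-twin (proj₁ y) d (twins z∈))
                                    (cong (updatedType (proj₁ y) d e) (tracked-type (there z∈)))
      }
      where
      open Tracks tracks
      apart : ∀ {z} → z ∈ R → z ≡ d → d ∈ R
      apart z∈ refl = z∈
      twins : ∀ {z} → z ∈ R → Twins (proj₁ (proj₁ y)) d z e
      twins {z} z∈ = record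
        { d-apart = (d∉R ∘ λ { refl → z∈ }) , (d∉R ∘ λ { refl → e∈R })
        ; t-apart = (proj₂ (z-avoids) ∘ sym) , (proj₂ e-avoids ∘ sym)
        ; s-apart = (proj₁ (z-avoids) ∘ sym) , (proj₁ e-avoids ∘ sym)
        ; same-out = λ w → trans (shape z w) (trans (proj₁ layered-twins′ w) (sym (shape e w)))
        ; same-in  = λ w → trans (shape w z) (trans (proj₂ layered-twins′ w) (sym (shape w e)))
        ; same-builtIn = λ j us → twin z∈ (∈-allAtoms (biS P) 3 (j , us))
        }
        where
        z-avoids : z ≢ s × z ≢ t
        z-avoids = X-avoids (R⊆X z∈)
        e-avoids : e ≢ s × e ≢ t
        e-avoids = X-avoids (R⊆X e∈R)
        layered-twins′ : (∀ w → layered inX right z w ≡ layered inX right e w)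
                       × (∀ w → layered inX right w z ≡ layered inX right w e)
        layered-twins′ = layered-twins inX right
          (proj₁ z-avoids) (proj₁ e-avoids) (proj₂ z-avoids) (proj₂ e-avoids)
          (trans (isYes-true (z ∈? X) (R⊆X z∈)) (sym (isYes-true (e ∈? X) (R⊆X e∈R))))
          (trans (right-on-R (there z∈)) (sym (right-on-R (there e∈R))))

    tracks-run : ∀ D R {y} → EndHomogeneous twinTest atoms e (D ++ R) → Unique (D ++ R ++ [ e ]) →
      (∀ {z} → z ∈ D ++ R ++ [ e ] → z ∈ X) →
      Tracks y (D ++ R ++ [ e ]) → Tracks (foldl next y D) (R ++ [ e ])
    tracks-run []      R _               _              _   tracks = tracks
    tracks-run (d ∷ D) R (twin ∷ end′) (d∉ ∷ unique) ⊆X tracks =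
      tracks-run D R end′ unique (⊆X ∘ there)
        (tracks-next tracks (λ d∈ → All.lookup d∉ d∈ refl) (∈-++⁺ʳ D (∈-++⁺ʳ R (here refl)))
          (⊆X ∘ there)
          λ z∈ a∈ → [ twin a∈ , (λ { refl → refl }) ]′ (∈-++-[]⁻ D z∈))
      where
      ∈-++-[]⁻ : ∀ D {z} → z ∈ D ++ R ++ [ e ] → z ∈ D ++ R ⊎ z ≡ e
      ∈-++-[]⁻ []      z∈ with ∈-++⁻ R z∈
      ... | inj₁ z∈R         = inj₁ z∈R
      ... | inj₂ (here z≡e)  = inj₂ z≡e
      ∈-++-[]⁻ (x ∷ D) (here z≡x) = inj₁ (here z≡x)
      ∈-++-[]⁻ (x ∷ D) (there z∈) with ∈-++-[]⁻ D z∈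
      ... | inj₁ z∈′ = inj₁ (there z∈′)
      ... | inj₂ z≡e = inj₂ z≡e

    tracks-prefix : ∀ D R → D ++ R ≡ ds → Tracks (foldl next start D) (R ++ [ e ])
    tracks-prefix D R D++R≡ds = tracks-run D R
      (subst (EndHomogeneous twinTest atoms e) (sym D++R≡ds) end)
      (subst Unique (sym X≡) X-unique)
      (subst (_ ∈_) X≡)
      (subst (Tracks start) (sym X≡) tracks-start)
      where
      X≡ : D ++ R ++ [ e ] ≡ X
      X≡ = trans (sym (++-assoc D R [ e ])) (cong (_++ [ e ]) D++R≡ds)

    S₀ : State (auxS P) (biS P) n
    S₀ = initState P s t E₀

    run-config : ∀ D D′ → runState P (deletions (D ++ D′)) S₀
                        ≡ toState (foldl deleteStep (proj₁ (foldl next start D)) D′)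
    run-config D D′ = trans (runState-deletions (D ++ D′) c₀) (cong toState
      (trans (foldl-++ deleteStep c₀ D D′) (cong (λ c → foldl deleteStep c D′) (sym (foldl-next D start)))))

    deletions-graph : ∀ D → applyAll (deletions D) E₀ ≗₂ layered inX (inX without D)
    deletions-graph D = deletions-shape inX-avoids D inX λ _ _ → refl

    deletions-valid-⊆ : ∀ {D} → D ⊆ X → Valid1L s t E₀ (deletions D)
    deletions-valid-⊆ {D} D⊆X = deletions-valid inX-avoids D inX inX-avoids (λ _ _ → refl)
      (unique-⊆ D⊆X X-unique) (isYes-true (_ ∈? X) ∘ Any-resp-⊆ D⊆X)

    unreachable-after-X : ¬ Reach (applyAll (deletions X) E₀) s t
    unreachable-after-X =
      layered-unreachable inX-avoids (λ ()) (without-covered X inX λ x → isYes-true⁻¹ (x ∈? X))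
      ∘ Path-resp-≗₂ (deletions-graph X)

    module Split (p₁ : List (Fin n)) (d : Fin n) (p₂ p₃ : List (Fin n))
                 (split : ds ≡ p₁ ++ d ∷ p₂ ++ p₃)
                 (same-code : code (foldl next start p₁) ≡ code (foldl next start (p₁ ++ d ∷ p₂))) where

      R₃ : List (Fin n)
      R₃ = p₃ ++ [ e ]

      y₁ y₂ : Tracker
      y₁ = foldl next start p₁
      y₂ = foldl next start (p₁ ++ d ∷ p₂)

      X-split : X ≡ p₁ ++ d ∷ p₂ ++ R₃
      X-split = trans (cong (_++ [ e ]) split)
        (trans (++-assoc p₁ (d ∷ p₂ ++ p₃) [ e ]) (cong (λ q → p₁ ++ d ∷ q) (++-assoc p₂ p₃ [ e ])))

      tracks₁ : Tracks y₁ ((d ∷ p₂ ++ p₃) ++ [ e ])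
      tracks₁ = tracks-prefix p₁ (d ∷ p₂ ++ p₃) (sym split)

      tracks₂ : Tracks y₂ R₃
      tracks₂ = tracks-prefix (p₁ ++ d ∷ p₂) p₃ (trans (++-assoc p₁ (d ∷ p₂) p₃) (sym split))

      R₃⊆₁ : R₃ ⊆ (d ∷ p₂ ++ p₃) ++ [ e ]
      R₃⊆₁ = ++⁺ (++⁺ˡ (d ∷ p₂) ⊆-refl) ⊆-refl

      Z : Fin n → Set
      Z x = x ∈ s ∷ t ∷ R₃

      same-s-type : auxType (proj₂ (proj₁ y₁)) s ≡ auxType (proj₂ (proj₁ y₂)) s
      same-s-type = proj₁ (code-injective {y₁} {y₂} same-code)

      same-t-type : auxType (proj₂ (proj₁ y₁)) t ≡ auxType (proj₂ (proj₁ y₂)) t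
      same-t-type = proj₁ (proj₂ (code-injective {y₁} {y₂} same-code))

      same-type-map : ∀ τ → proj₂ y₁ τ ≡ proj₂ y₂ τ
      same-type-map = proj₂ (proj₂ (code-injective {y₁} {y₂} same-code))

      agree : Agree Z (proj₁ y₁) (proj₁ y₂)
      agree = rows , types
        where
        open Tracks
        s∉X : s ∉ X
        s∉X s∈ = proj₁ (X-avoids s∈) refl
        t∉X : t ∉ X
        t∉X t∈ = proj₂ (X-avoids t∈) refl
        same-right : ∀ {x} → Z x → right tracks₁ x ≡ right tracks₂ x
        same-right (here refl)         = trans (right-outside tracks₁ s∉X) (sym (right-outside tracks₂ s∉X))
        same-right (there (here refl)) = trans (right-outside tracks₁ t∉X) (sym (right-outside tracks₂ t∉X))
        same-right (there (there x∈))  =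
          trans (right-on-R tracks₁ (Any-resp-⊆ R₃⊆₁ x∈)) (sym (right-on-R tracks₂ x∈))
        rows : ∀ {x} → Z x → ∀ w → proj₁ (proj₁ y₁) x w ≡ proj₁ (proj₁ y₂) x w
        rows {x} Zx w = trans (shape tracks₁ x w)
          (trans (cong (λ b → (⌊ x ≟ᶠ s ⌋ ∧ inX w) ∨ (b ∧ ⌊ w ≟ᶠ t ⌋)) (same-right Zx))
                 (sym (shape tracks₂ x w)))
        types : ∀ {x} → Z x → auxType (proj₂ (proj₁ y₁)) x ≡ auxType (proj₂ (proj₁ y₂)) x
        types (here refl)         = same-s-type
        types (there (here refl)) = same-t-type
        types (there (there x∈))  = trans (tracked-type tracks₁ (Any-resp-⊆ R₃⊆₁ x∈))
          (trans (same-type-map _) (sym (tracked-type tracks₂ x∈)))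

      α₁ : List (Mod n)
      α₁ = deletions (p₁ ++ R₃)

      p₁++R₃⊆X : p₁ ++ R₃ ⊆ X
      p₁++R₃⊆X = subst (p₁ ++ R₃ ⊆_) (sym X-split) (++⁺ ⊆-refl (++⁺ˡ (d ∷ p₂) ⊆-refl))

      reachable-after-α₁ : Reach (applyAll α₁ E₀) s t
      reachable-after-α₁ = Path-resp-≗₂ (λ x y → sym (deletions-graph (p₁ ++ R₃) x y))
        (layered-reach inX-avoids (inX without (p₁ ++ R₃)) inX-d
                       (trans (without-∉ (p₁ ++ R₃) inX d∉) inX-d))
        where
        inX-d : inX d ≡ true
        inX-d = isYes-true (d ∈? X) (subst (d ∈_) (sym X-split) (∈-++⁺ʳ p₁ (here refl)))
        d∉ : d ∉ p₁ ++ R₃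
        d∉ = unique-middle p₁ (subst Unique X-split X-unique)
           ∘ Any-resp-⊆ (++⁺ (⊆-refl {x = p₁}) (++⁺ˡ p₂ ⊆-refl))

      same-query : queryValue P (runState P α₁ S₀) ≡ queryValue P (runState P (deletions X) S₀)
      same-query = begin
        queryValue P (runState P α₁ S₀)
          ≡⟨ cong (queryValue P) (run-config p₁ R₃) ⟩
        queryValue P (toState c₁)
          ≡⟨ queryValue-toState c₁ ⟩
        Vec.lookup (auxType (proj₂ c₁) s) (Q P)
          ≡⟨ cong (λ τ → Vec.lookup τ (Q P)) (proj₂ final-agree (here refl)) ⟩
        Vec.lookup (auxType (proj₂ c₂) s) (Q P)
          ≡⟨ sym (queryValue-toState c₂) ⟩
        queryValue P (toState c₂)
          ≡⟨ cong (queryValue P) (sym (run-config (p₁ ++ d ∷ p₂) R₃)) ⟩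
        queryValue P (runState P (deletions ((p₁ ++ d ∷ p₂) ++ R₃)) S₀)
          ≡⟨ cong (λ D → queryValue P (runState P (deletions D) S₀))
                  (trans (++-assoc p₁ (d ∷ p₂) R₃) (sym X-split)) ⟩
        queryValue P (runState P (deletions X) S₀) ∎
        where
        open ≡-Reasoning
        c₁ c₂ : Config
        c₁ = foldl deleteStep (proj₁ y₁) R₃
        c₂ = foldl deleteStep (proj₁ y₂) R₃
        final-agree : Agree Z c₁ c₂
        final-agree =
          deletions-agree (here refl) (there (here refl)) (All.tabulate (there ∘ there)) agree

proposition4p8 : (P : DynProgram) → Unary P → ¬ Maintains1L P
proposition4p8 P unary maintains =
  let open LowerBound P unary
      open Layered s t using (deletions)
      ds , e , |ds|≡codes , X⊆pool , end =
        end-homogeneous-sublist twinTest atoms codes pool (≤-reflexive (sym pool-length))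
      open Chosen ds e X⊆pool end
      p₁ , d , p₂ , p₃ , split , same-code =
        repeated-prefix (code ∘ foldl next start) ds (≤-reflexive (sym |ds|≡codes))
      open Split p₁ d p₂ p₃ split same-code
      correct = maintains n s t E₀ E₀-oneLayered
  in unreachable-after-X (Equivalence.to (correct (deletions X) (deletions-valid-⊆ ⊆-refl))
       (subst (_≡ true) same-query
         (Equivalence.from (correct α₁ (deletions-valid-⊆ p₁++R₃⊆X)) reachable-after-α₁)))
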